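{- For the Prism allied graph $\mathbb{D}^{t}_{n}$ with $n\ge 4$, the independent mixed metric number of $\mathbb{D}^{t}_{n}$ equals $n+1$.
   Context: For an integer $n\ge 3$, the Prism allied graph $\mathbb{D}^{t}_{n}$ has vertex set $\{p_i,q_i,r_i,s_i : 1\le i\le n\}$ and edge set $\{p_iq_i,\ p_ip_{i+1},\ q_iq_{i+1},\ r_iq_i,\ r_iq_{i+1},\ r_is_i : 1\le i\le n\}$, with indices taken modulo $n$. For a connected graph $H$, $d_H(u,v)$ is the shortest-path distance, and for a vertex $x$ and an edge $e=uv$, $d_H(x,e)=\min\{d_H(x,u),d_H(x,v)\}$. A set $M\subseteq V(H)$ is a mixed metric generator of $H$ if for every two distinct elements $y_1,y_2\in V(H)\cup E(H)$ there is a vertex $z\in M$ with $d_H(z,y_1)\ne d_H(z,y_2)$. An independent mixed metric generator is a mixed metric generator that is an independent set (no two of its vertices are adjacent); the independent mixed metric number of $H$ is the minimum cardinality of an independent mixed metric generator of $H$. -}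

module Defs where

open import Data.Nat using (ℕ; zero; suc; _+_; _≤_; _⊓_)
open import Data.Nat.DivMod using (_mod_)
open import Data.Fin using (Fin; toℕ)
open import Data.Product using (_×_; _,_; ∃; ∃-syntax; proj₁; proj₂)
open import Data.Sum using (_⊎_; inj₁; inj₂)
open import Data.List using (List; length)
open import Data.List.Membership.Propositional using (_∈_)
open import Data.List.Relation.Unary.Unique.Propositional using (Unique)
open import Relation.Binary.PropositionalEquality using (_≡_; _≢_)
open import Relation.Nullary using (¬_)

-- successor modulo n on indices (indices 0..n-1 stand for 1..n)
next : ∀ {n} → Fin n → Fin n
next {suc m} i = suc (toℕ i) mod (suc m)

data Kind : Set where
  P Q R S : Kind

Vertex : ℕ → Set
Vertex n = Kind × Fin n

data ELabel : Set where
  pq pp qq rq rq' rs : ELabel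

Edge : ℕ → Set
Edge n = ELabel × Fin n

ends : ∀ {n} → Edge n → Vertex n × Vertex n
ends (pq  , i) = (P , i) , (Q , i)
ends (pp  , i) = (P , i) , (P , next i)
ends (qq  , i) = (Q , i) , (Q , next i)
ends (rq  , i) = (R , i) , (Q , i)
ends (rq' , i) = (R , i) , (Q , next i)
ends (rs  , i) = (R , i) , (S , i)

Adj : ∀ {n} → Vertex n → Vertex n → Set
Adj {n} u v = ∃[ e ] (ends {n} e ≡ (u , v) ⊎ ends {n} e ≡ (v , u))

data Walk {n : ℕ} : Vertex n → Vertex n → ℕ → Set where
  here : ∀ {u} → Walk u u 0
  step : ∀ {u w v k} → Adj u w → Walk w v k → Walk u v (suc k)

Dist : ∀ {n} → Vertex n → Vertex n → ℕ → Set
Dist u v k = Walk u v k × (∀ m → Walk u v m → k ≤ m)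

Element : ℕ → Set
Element n = Vertex n ⊎ Edge n

DistEl : ∀ {n} → Vertex n → Element n → ℕ → Set
DistEl x (inj₁ v) k = Dist x v k
DistEl x (inj₂ e) k =
  ∃[ a ] ∃[ b ] (Dist x (proj₁ (ends e)) a × Dist x (proj₂ (ends e)) b × k ≡ a ⊓ b)

Distinguishes : ∀ {n} → Vertex n → Element n → Element n → Set
Distinguishes z y₁ y₂ = ∀ a b → DistEl z y₁ a → DistEl z y₂ b → a ≢ b

MixedMetricGenerator : ∀ n → List (Vertex n) → Set
MixedMetricGenerator n M =
  ∀ (y₁ y₂ : Element n) → y₁ ≢ y₂ → ∃[ z ] (z ∈ M × Distinguishes z y₁ y₂)

Independent : ∀ n → List (Vertex n) → Set
Independent n M = ∀ {u v} → u ∈ M → v ∈ M → ¬ Adj u v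

IndependentMMG : ∀ n → List (Vertex n) → Set
IndependentMMG n M = Independent n M × MixedMetricGenerator n M

-- k is the independent mixed metric number of D^t_n
-- (sets are represented as duplicate-free lists; cardinality = length)
IsIndependentMixedMetricNumber : ℕ → ℕ → Set
IsIndependentMixedMetricNumber n k =
  (∃[ M ] (Unique M × IndependentMMG n M × length M ≡ k))
  × (∀ (M : List (Vertex n)) → Unique M → IndependentMMG n M → k ≤ length M)

-- The distance from a pendant vertex s_j has a closed form δ in the offset of the
-- target index from j. It is certified by a potential argument: a function that vanishes
-- only at s_j, changes by at most one along every edge, and at every other vertex drops
-- by one along some edge, is the distance from s_j. With these formulas, two distinct
-- elements are separated by one of s_{i-2}, s_{i-1}, s_i, s_{i+1}, where i is the index of
-- the first one, unless they are q_i and p_i q_i; those are separated by p_1, because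
-- projecting a walk onto the p-cycle makes any walk that leaves the cycle strictly shorter.
-- This finite case analysis is a decision procedure, evaluated by enumeration for n ≤ 6 and
-- symbolically in n for n ≥ 7. So {p_1, s_1, ..., s_n} is an independent mixed metric
-- generator. Conversely r_i and r_i s_i are separated only by s_i, and no s_j separates q_1
-- from p_1 q_1, so every mixed metric generator has at least n + 1 vertices.
{-# OPTIONS --safe #-}
module Submission where

open import Defs
open import Data.Empty using (⊥-elim)
open import Data.Fin as Fin using (Fin; #_; toℕ)
open import Data.Fin.Patterns using (0F; 1F; 2F; 3F)
open import Data.Fin.Properties
  using (any?; all?; toℕ-fromℕ<; toℕ-fromℕ; toℕ-inject₁; toℕ-injective; toℕ<n)
open import Data.List using (List; []; _∷_; _++_; map; length; allFin)
open import Data.List.Properties using (length-++; length-map; length-tabulate)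
open import Data.List.Membership.Propositional using (_∈_; _∉_)
open import Data.List.Membership.Propositional.Properties
  using (∈-map⁺; ∈-map⁻; ∈-allFin; ∈-∃++; ∈-++⁻; ∈-++⁺ˡ; ∈-++⁺ʳ)
open import Data.List.Relation.Binary.Subset.Propositional using (_⊆_)
open import Data.List.Relation.Unary.All as All using ()
open import Data.List.Relation.Unary.AllPairs using (_∷_)
open import Data.List.Relation.Unary.Any using (here; there)
open import Data.List.Relation.Unary.Unique.Propositional using (Unique)
import Data.List.Relation.Unary.Unique.Propositional.Properties as Unique
open import Data.Nat
open import Data.Nat.DivMod
open import Data.Nat.Properties
open import Data.Product using (_×_; _,_; proj₁; proj₂; ∃-syntax)
open import Data.Sum using (_⊎_; inj₁; inj₂)
open import Data.Vec using (Vec; []; _∷_; lookup)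
open import Function using (id)
open import Relation.Binary.Definitions using (DecidableEquality)
open import Relation.Binary.PropositionalEquality
open import Relation.Nullary using (¬_; yes; no; Dec; ¬?; contradiction)
open import Relation.Nullary.Decidable using (True; toWitness; map′; _×-dec_; _⊎-dec_)

⊆⇒length≤ : ∀ {A : Set} {xs ys : List A} → Unique xs → xs ⊆ ys → length xs ≤ length ys
⊆⇒length≤ {xs = []} _ _ = z≤n
⊆⇒length≤ {xs = x ∷ xs} (x∉xs ∷ unique) xs⊆ys with ∈-∃++ (xs⊆ys (here refl))
... | us , vs , refl = begin
  suc (length xs)             ≤⟨ s≤s (⊆⇒length≤ unique xs⊆us++vs) ⟩
  suc (length (us ++ vs))     ≡⟨ cong suc (length-++ us) ⟩
  suc (length us + length vs) ≡⟨ +-suc (length us) (length vs) ⟨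
  length us + suc (length vs) ≡⟨ length-++ us ⟨
  length (us ++ x ∷ vs)       ∎
  where
  open ≤-Reasoning
  xs⊆us++vs : xs ⊆ us ++ vs
  xs⊆us++vs y∈xs with ∈-++⁻ us (xs⊆ys (there y∈xs))
  ... | inj₁ y∈us = ∈-++⁺ˡ y∈us
  ... | inj₂ (here y≡x) = ⊥-elim (All.lookup x∉xs y∈xs (sym y≡x))
  ... | inj₂ (there y∈vs) = ∈-++⁺ʳ us y∈vs

[m%n+o]%n≡[m+o]%n : ∀ m o n .{{_ : NonZero n}} → (m % n + o) % n ≡ (m + o) % n
[m%n+o]%n≡[m+o]%n m o n = begin
  (m % n + o) % n         ≡⟨ %-distribˡ-+ (m % n) o n ⟩
  (m % n % n + o % n) % n ≡⟨ cong (λ z → (z + o % n) % n) (m%n%n≡m%n m n) ⟩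
  (m % n + o % n) % n     ≡⟨ %-distribˡ-+ m o n ⟨
  (m + o) % n             ∎
  where open ≡-Reasoning

[m+o%n]%n≡[m+o]%n : ∀ m o n .{{_ : NonZero n}} → (m + o % n) % n ≡ (m + o) % n
[m+o%n]%n≡[m+o]%n m o n = begin
  (m + o % n) % n ≡⟨ cong (_% n) (+-comm m (o % n)) ⟩
  (o % n + m) % n ≡⟨ [m%n+o]%n≡[m+o]%n o m n ⟩
  (o + m) % n     ≡⟨ cong (_% n) (+-comm o m) ⟩
  (m + o) % n     ∎
  where open ≡-Reasoning

module _ {n : ℕ} where

  Adj-sym : {u v : Vertex n} → Adj u v → Adj v u
  Adj-sym (e , inj₁ p) = e , inj₂ p
  Adj-sym (e , inj₂ p) = e , inj₁ p

  ends-adjacent : (e : Edge n) → Adj (proj₁ (ends e)) (proj₂ (ends e))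
  ends-adjacent e = e , inj₁ refl

  ends-adjacent′ : (e : Edge n) → Adj (proj₂ (ends e)) (proj₁ (ends e))
  ends-adjacent′ e = e , inj₂ refl

  snoc : ∀ {u v w : Vertex n} {k} → Walk u v k → Adj v w → Walk u w (suc k)
  snoc here a = step a here
  snoc (step a′ r) a = step a′ (snoc r a)

  reverse : ∀ {u v : Vertex n} {k} → Walk u v k → Walk v u k
  reverse here = here
  reverse (step a r) = snoc (reverse r) (Adj-sym a)

  Dist-sym : ∀ {u v : Vertex n} {k} → Dist u v k → Dist v u k
  Dist-sym (r , shortest) = reverse r , λ m r′ → shortest m (reverse r′)

  Dist-unique : ∀ {u v : Vertex n} {a b} → Dist u v a → Dist u v b → a ≡ b
  Dist-unique (ra , sa) (rb , sb) = ≤-antisym (sa _ rb) (sb _ ra)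

  DistEl-unique : ∀ {z : Vertex n} {y a b} → DistEl z y a → DistEl z y b → a ≡ b
  DistEl-unique {y = inj₁ v} da db = Dist-unique da db
  DistEl-unique {y = inj₂ e} (a₁ , b₁ , d₁ , d₂ , refl) (a₂ , b₂ , d₁′ , d₂′ , refl) =
    cong₂ _⊓_ (Dist-unique d₁ d₁′) (Dist-unique d₂ d₂′)

  DistEl-edge : ∀ {z : Vertex n} {e a b} →
                Dist z (proj₁ (ends e)) a → Dist z (proj₂ (ends e)) b → DistEl z (inj₂ e) (a ⊓ b)
  DistEl-edge da db = _ , _ , da , db , refl

  distinguishes : ∀ {z : Vertex n} {y₁ y₂ a b} → DistEl z y₁ a → DistEl z y₂ b → a ≢ b →
                  Distinguishes z y₁ y₂
  distinguishes d₁ d₂ a≢b a′ b′ d₁′ d₂′ a′≡b′ =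
    a≢b (trans (DistEl-unique d₁ d₁′) (trans a′≡b′ (DistEl-unique d₂′ d₂)))

  Distinguishes-sym : ∀ {z : Vertex n} {y₁ y₂} → Distinguishes z y₁ y₂ → Distinguishes z y₂ y₁
  Distinguishes-sym d a b d₁ d₂ a≡b = d b a d₂ d₁ (sym a≡b)

-- Distance from a potential

module _ {n : ℕ} (src : Vertex n) (f : Vertex n → ℕ)
         (lipschitz : ∀ {u v} → Adj u v → f v ≤ suc (f u))
         (descent : ∀ v k → f v ≡ suc k → ∃[ w ] (Adj w v × f w ≡ k))
         (f-src : f src ≡ 0) (vanishes-only-at-src : ∀ v → f v ≡ 0 → v ≡ src) where

  walk-potential : ∀ {u v k} → Walk u v k → f v ≤ f u + k
  walk-potential {u} here = ≤-reflexive (sym (+-identityʳ (f u)))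
  walk-potential {u} {v} (step {w = w} {k = k} a r) = begin
    f v           ≤⟨ walk-potential r ⟩
    f w + k       ≤⟨ +-monoˡ-≤ k (lipschitz a) ⟩
    suc (f u) + k ≡⟨ +-suc (f u) k ⟨
    f u + suc k   ∎
    where open ≤-Reasoning

  walk-from-src : ∀ k v → f v ≡ k → Walk src v k
  walk-from-src zero v fv≡0 rewrite vanishes-only-at-src v fv≡0 = here
  walk-from-src (suc k) v fv≡1+k with descent v k fv≡1+k
  ... | w , w~v , fw≡k = snoc (walk-from-src k w fw≡k) w~v

  dist-from-potential : ∀ v → Dist src v (f v)
  dist-from-potential v = walk-from-src (f v) v refl , λ k r → begin
    f v       ≤⟨ walk-potential r ⟩
    f src + k ≡⟨ cong (_+ k) f-src ⟩
    k         ∎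
    where open ≤-Reasoning

-- Projection onto the p-cycle

module _ {n : ℕ} where

  rim : Vertex n → Vertex n
  rim (_ , i) = P , i

  rim-adj : {u v : Vertex n} → Adj u v → rim u ≡ rim v ⊎ Adj (rim u) (rim v)
  rim-adj ((pq  , i) , inj₁ refl) = inj₁ refl
  rim-adj ((rq  , i) , inj₁ refl) = inj₁ refl
  rim-adj ((rs  , i) , inj₁ refl) = inj₁ refl
  rim-adj ((pq  , i) , inj₂ refl) = inj₁ refl
  rim-adj ((rq  , i) , inj₂ refl) = inj₁ refl
  rim-adj ((rs  , i) , inj₂ refl) = inj₁ refl
  rim-adj ((pp  , i) , inj₁ refl) = inj₂ (ends-adjacent (pp , i))
  rim-adj ((qq  , i) , inj₁ refl) = inj₂ (ends-adjacent (pp , i))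
  rim-adj ((rq' , i) , inj₁ refl) = inj₂ (ends-adjacent (pp , i))
  rim-adj ((pp  , i) , inj₂ refl) = inj₂ (ends-adjacent′ (pp , i))
  rim-adj ((qq  , i) , inj₂ refl) = inj₂ (ends-adjacent′ (pp , i))
  rim-adj ((rq' , i) , inj₂ refl) = inj₂ (ends-adjacent′ (pp , i))

  rim-walk : ∀ {u v : Vertex n} {k} → Walk u v k → ∃[ k′ ] (k′ ≤ k × Walk (rim u) (rim v) k′)
  rim-walk here = 0 , z≤n , here
  rim-walk {v = v} (step a r) with rim-walk r | rim-adj a
  ... | k′ , k′≤k , r′ | inj₁ same = k′ , m≤n⇒m≤1+n k′≤k , subst (λ x → Walk x (rim v) k′) (sym same) r′
  ... | k′ , k′≤k , r′ | inj₂ a′ = suc k′ , s≤s k′≤k , step a′ r′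

  leaving-rim : ∀ {a b κ} → Adj {n} (P , a) (κ , b) → κ ≢ P → a ≡ b
  leaving-rim ((pq , _) , inj₁ refl) _ = refl
  leaving-rim ((pp , _) , inj₁ refl) κ≢P = ⊥-elim (κ≢P refl)
  leaving-rim ((pp , _) , inj₂ refl) κ≢P = ⊥-elim (κ≢P refl)
  leaving-rim ((pq , _) , inj₂ ())
  leaving-rim ((qq , _) , inj₁ ())
  leaving-rim ((qq , _) , inj₂ ())
  leaving-rim ((rq , _) , inj₁ ())
  leaving-rim ((rq , _) , inj₂ ())
  leaving-rim ((rq' , _) , inj₁ ())
  leaving-rim ((rq' , _) , inj₂ ())
  leaving-rim ((rs , _) , inj₁ ())
  leaving-rim ((rs , _) , inj₂ ())

  rung-shortcut : ∀ {a c b κ κ′ k} → Adj {n} (P , a) (κ′ , c) → κ′ ≢ P → Walk (κ′ , c) (κ , b) k →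
                  ∃[ k′ ] (k′ < suc k × Walk (P , a) (P , b) k′)
  rung-shortcut a κ′≢P r with rim-walk r | leaving-rim a κ′≢P
  ... | k′ , k′≤k , r′ | refl = k′ , s≤s k′≤k , r′

  rim-shortcut : ∀ {a b κ k} → Walk {n} (P , a) (κ , b) k → κ ≢ P →
                 ∃[ k′ ] (k′ < k × Walk (P , a) (P , b) k′)
  rim-shortcut here κ≢P = ⊥-elim (κ≢P refl)
  rim-shortcut (step {w = P , _} a r) κ≢P with rim-shortcut r κ≢P
  ... | k′ , k′<k , r′ = suc k′ , s≤s k′<k , step a r′
  rim-shortcut (step {w = Q , _} a r) _ = rung-shortcut a (λ ()) r
  rim-shortcut (step {w = R , _} a r) _ = rung-shortcut a (λ ()) r
  rim-shortcut (step {w = S , _} a r) _ = rung-shortcut a (λ ()) r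

  rung-separated : ∀ {a i} → Distinguishes {n} (P , a) (inj₁ (Q , i)) (inj₂ (pq , i))
  rung-separated dq _ dQ (dp , dq′ , dP , dQ′ , refl) dq≡ = <⇒≢ dp<dq (sym (begin
    dq       ≡⟨ dq≡ ⟩
    dp ⊓ dq′ ≡⟨ cong (dp ⊓_) (Dist-unique dQ′ dQ) ⟩
    dp ⊓ dq  ≡⟨ m≤n⇒m⊓n≡m (<⇒≤ dp<dq) ⟩
    dp       ∎))
    where
    open ≡-Reasoning
    dp<dq : dp < dq
    dp<dq with rim-shortcut (proj₁ dQ) (λ ())
    ... | k , k<dq , r = ≤-<-trans (proj₂ dP k r) k<dq

  rung-separated′ : ∀ {a i} → Distinguishes {n} (P , a) (inj₂ (pq , i)) (inj₁ (Q , i))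
  rung-separated′ {i = i} = Distinguishes-sym {y₁ = inj₁ (Q , i)} {inj₂ (pq , i)} rung-separated

  adj-on-rim : ∀ {a b} → Adj {n} (P , a) (P , b) → b ≡ next a ⊎ a ≡ next b
  adj-on-rim ((pp , _) , inj₁ refl) = inj₁ refl
  adj-on-rim ((pp , _) , inj₂ refl) = inj₂ refl
  adj-on-rim ((pq , _) , inj₁ ())
  adj-on-rim ((pq , _) , inj₂ ())
  adj-on-rim ((qq , _) , inj₁ ())
  adj-on-rim ((qq , _) , inj₂ ())
  adj-on-rim ((rq , _) , inj₁ ())
  adj-on-rim ((rq , _) , inj₂ ())
  adj-on-rim ((rq' , _) , inj₁ ())
  adj-on-rim ((rq' , _) , inj₂ ())
  adj-on-rim ((rs , _) , inj₁ ())
  adj-on-rim ((rs , _) , inj₂ ())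

module _ {n : ℕ} where

  S-neighbour : ∀ {u : Vertex n} {i} → Adj u (S , i) → u ≡ (R , i)
  S-neighbour ((rs , _) , inj₁ refl) = refl
  S-neighbour ((rs , _) , inj₂ ())
  S-neighbour ((pq , _) , inj₁ ())
  S-neighbour ((pq , _) , inj₂ ())
  S-neighbour ((pp , _) , inj₁ ())
  S-neighbour ((pp , _) , inj₂ ())
  S-neighbour ((qq , _) , inj₁ ())
  S-neighbour ((qq , _) , inj₂ ())
  S-neighbour ((rq , _) , inj₁ ())
  S-neighbour ((rq , _) , inj₂ ())
  S-neighbour ((rq' , _) , inj₁ ())
  S-neighbour ((rq' , _) , inj₂ ())

  walk-into-S : ∀ {z : Vertex n} {i k} → Walk z (S , i) (suc k) → ∃[ k′ ] (k′ ≤ k × Walk z (R , i) k′)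
  walk-into-S (step a here) rewrite S-neighbour a = 0 , z≤n , here
  walk-into-S (step a (step a′ r)) with walk-into-S (step a′ r)
  ... | k′ , k′≤k , r′ = suc k′ , s≤s k′≤k , step a r′

  rs-separated-only-by-S : ∀ {z : Vertex n} {i d} → Dist z (S , i) d →
                           Distinguishes z (inj₁ (R , i)) (inj₂ (rs , i)) → z ≡ (S , i)
  rs-separated-only-by-S {d = zero} (here , _) _ = refl
  rs-separated-only-by-S {z = z} {i} {suc d} dS separates with walk-into-S (proj₁ dS)
  ... | k , k≤d , r = ⊥-elim (separates k (k ⊓ suc d) dR (DistEl-edge {e = rs , i} dR dS)
                                        (sym (m≤n⇒m⊓n≡m (m≤n⇒m≤1+n k≤d))))
    where
    dR : Dist z (R , i) k
    dR = r , λ m r′ → ≤-pred (≤-trans (s≤s k≤d) (proj₂ dS (suc m) (snoc r′ (ends-adjacent (rs , i)))))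

-- An arc (t , w) places an index i relative to a base index j on the n-cycle:
-- t = (i − j) mod n and w = n − t. Only arcs with w ≥ 1 occur; forward and backward
-- move i by one step without referring to n.
Arc : Set
Arc = ℕ × ℕ

forward : Arc → Arc
forward (t , suc (suc w)) = suc t , suc w
forward (t , 1) = 0 , suc t
forward (t , 0) = t , 0

backward : Arc → Arc
backward (suc t , w) = t , suc w
backward (0 , w) = pred w , 1

backward-forward : ∀ t w → backward (forward (t , suc w)) ≡ (t , suc w)
backward-forward t zero = refl
backward-forward t (suc w) = refl

gap : Arc → ℕ
gap (t , w) = (t ∸ 1) ⊓ w

-- δ κ x = d(s_j, κ_i) when i lies at arc x from j: a shortest walk runs s_j r_j, then q_j or
-- q_{j+1}, then gap x steps along the q-cycle.
δ : Kind → Arc → ℕ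
δ S (zero , w) = 0
δ S (suc t , w) = 4 + t ⊓ (w ∸ 1)
δ R (zero , w) = 1
δ R (suc t , w) = 3 + t ⊓ (w ∸ 1)
δ Q x = 2 + gap x
δ P x = 3 + gap x

one-less : ∀ {a b k} → a ≡ suc b → a ≡ suc k → b ≡ k
one-less a≡1+b a≡1+k = suc-injective (trans (sym a≡1+b) a≡1+k)

Close : ℕ → ℕ → Set
Close a b = a ≤ suc b × b ≤ suc a

Close-+ : ∀ c {a b} → Close a b → Close (c + a) (c + b)
Close-+ c {a} {b} (a≤1+b , b≤1+a) =
  ≤-trans (+-monoʳ-≤ c a≤1+b) (≤-reflexive (+-suc c b)) ,
  ≤-trans (+-monoʳ-≤ c b≤1+a) (≤-reflexive (+-suc c a))

gap-forward : ∀ t w → Close (gap (t , suc w)) (gap (forward (t , suc w)))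
gap-forward t zero = ≤-trans (m⊓n≤n (t ∸ 1) 1) (s≤s z≤n) , z≤n
gap-forward zero (suc w) = z≤n , z≤n
gap-forward (suc t) (suc w) =
  ⊓-monoˡ-≤ (2 + w) (m≤n+m t 2) , s≤s (⊓-monoʳ-≤ t (m≤n+m w 2))

⊓-≤-⊓-suc : ∀ t w → t ⊓ w ≤ t ⊓ suc w
⊓-≤-⊓-suc t w = ⊓-monoʳ-≤ t (n≤1+n w)

⊓-suc-≤-suc-⊓ : ∀ t w → t ⊓ suc w ≤ suc (t ⊓ w)
⊓-suc-≤-suc-⊓ t w = ⊓-monoˡ-≤ (suc w) (n≤1+n t)

δ-PQ : ∀ x → Close (δ P x) (δ Q x)
δ-PQ x = ≤-refl , m≤n⇒m≤1+n (n≤1+n (δ Q x))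

δ-PP-forward : ∀ t w → Close (δ P (t , suc w)) (δ P (forward (t , suc w)))
δ-PP-forward t w = Close-+ 3 (gap-forward t w)

δ-QQ-forward : ∀ t w → Close (δ Q (t , suc w)) (δ Q (forward (t , suc w)))
δ-QQ-forward t w = Close-+ 2 (gap-forward t w)

δ-RQ : ∀ t w → Close (δ R (t , suc w)) (δ Q (t , suc w))
δ-RQ zero w = s≤s z≤n , s≤s (s≤s z≤n)
δ-RQ (suc t) w = Close-+ 2 (s≤s (⊓-≤-⊓-suc t w) , m≤n⇒m≤1+n (⊓-suc-≤-suc-⊓ t w))

δ-RQ-forward : ∀ t w → Close (δ R (t , suc w)) (δ Q (forward (t , suc w)))
δ-RQ-forward zero zero = s≤s z≤n , s≤s (s≤s z≤n)
δ-RQ-forward zero (suc w) = s≤s z≤n , s≤s (s≤s z≤n)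
δ-RQ-forward (suc t) zero = +-monoʳ-≤ 3 (m⊓n≤n t 0) , s≤s (s≤s z≤n)
δ-RQ-forward (suc t) (suc w) = Close-+ 3 (⊓-suc-≤-suc-⊓ t w , m≤n⇒m≤1+n (⊓-≤-⊓-suc t w))

δ-RS : ∀ t w → Close (δ R (t , suc w)) (δ S (t , suc w))
δ-RS zero w = ≤-refl , z≤n
δ-RS (suc t) w = m≤n⇒m≤1+n (n≤1+n _) , ≤-refl

Descends : Kind → Arc → Set
Descends S x = δ S x ≡ 0 ⊎ δ S x ≡ suc (δ R x)
Descends R x = δ R x ≡ suc (δ S x) ⊎ δ R x ≡ suc (δ Q x) ⊎ δ R x ≡ suc (δ Q (forward x))
Descends Q x = δ Q x ≡ suc (δ R x) ⊎ δ Q x ≡ suc (δ R (backward x)) ⊎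
               δ Q x ≡ suc (δ Q (backward x)) ⊎ δ Q x ≡ suc (δ Q (forward x))
Descends P x = δ P x ≡ suc (δ Q x)

δ-descends : ∀ κ t w → Descends κ (t , suc w)
δ-descends S zero w = inj₁ refl
δ-descends S (suc t) w = inj₂ refl
δ-descends R zero w = inj₁ refl
δ-descends R (suc t) w with t ≤? w
... | yes t≤w = inj₂ (inj₁ (cong (3 +_) (trans (m≤n⇒m⊓n≡m t≤w) (sym (m≤n⇒m⊓n≡m (m≤n⇒m≤1+n t≤w))))))
δ-descends R (suc t) zero | no _ = inj₂ (inj₂ (cong (3 +_) (⊓-zeroʳ t)))
δ-descends R (suc t) (suc w) | no t≰1+w =
  inj₂ (inj₂ (cong (3 +_) (trans (m≥n⇒m⊓n≡n 1+w≤t) (cong suc (sym (m≥n⇒m⊓n≡n (<⇒≤ 1+w≤t)))))))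
  where 1+w≤t : suc w ≤ t
        1+w≤t = <⇒≤ (≰⇒> t≰1+w)
δ-descends Q zero w = inj₁ refl
δ-descends Q (suc zero) w = inj₂ (inj₁ refl)
δ-descends Q (suc (suc t)) w with t ≤? w
... | yes t≤w = inj₂ (inj₂ (inj₁ (cong (3 +_)
                  (trans (m≤n⇒m⊓n≡m t≤w) (sym (m≤n⇒m⊓n≡m (≤-trans t≤w (m≤n+m w 2))))))))
δ-descends Q (suc (suc t)) zero | no _ = inj₂ (inj₂ (inj₂ (cong (3 +_) (⊓-zeroʳ t))))
δ-descends Q (suc (suc t)) (suc w) | no t≰1+w =
  inj₂ (inj₂ (inj₂ (cong (3 +_) (trans (m≥n⇒m⊓n≡n 1+w≤t) (cong suc (sym (m≥n⇒m⊓n≡n w≤1+t)))))))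
  where 1+w≤t : suc w ≤ t
        1+w≤t = <⇒≤ (≰⇒> t≰1+w)
        w≤1+t : w ≤ suc t
        w≤1+t = ≤-trans (n≤1+n w) (m≤n⇒m≤1+n 1+w≤t)
δ-descends P t w = refl

δ≡0 : ∀ κ x → δ κ x ≡ 0 → κ ≡ S × proj₁ x ≡ 0
δ≡0 S (zero , w) _ = refl , refl
δ≡0 S (suc t , w) ()
δ≡0 R (zero , w) ()
δ≡0 R (suc t , w) ()
δ≡0 Q x ()
δ≡0 P x ()

ElementKind : Set
ElementKind = Kind ⊎ ELabel

elementKinds : Vec ElementKind 10
elementKinds = inj₁ P ∷ inj₁ Q ∷ inj₁ R ∷ inj₁ S ∷
               inj₂ pq ∷ inj₂ pp ∷ inj₂ qq ∷ inj₂ rq ∷ inj₂ rq' ∷ inj₂ rs ∷ []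

kindIndex : ElementKind → Fin 10
kindIndex (inj₁ P) = # 0
kindIndex (inj₁ Q) = # 1
kindIndex (inj₁ R) = # 2
kindIndex (inj₁ S) = # 3
kindIndex (inj₂ pq) = # 4
kindIndex (inj₂ pp) = # 5
kindIndex (inj₂ qq) = # 6
kindIndex (inj₂ rq) = # 7
kindIndex (inj₂ rq') = # 8
kindIndex (inj₂ rs) = # 9

lookup-kindIndex : ∀ k → lookup elementKinds (kindIndex k) ≡ k
lookup-kindIndex (inj₁ P) = refl
lookup-kindIndex (inj₁ Q) = refl
lookup-kindIndex (inj₁ R) = refl
lookup-kindIndex (inj₁ S) = refl
lookup-kindIndex (inj₂ pq) = refl
lookup-kindIndex (inj₂ pp) = refl
lookup-kindIndex (inj₂ qq) = refl
lookup-kindIndex (inj₂ rq) = refl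
lookup-kindIndex (inj₂ rq') = refl
lookup-kindIndex (inj₂ rs) = refl

_≟ₖ_ : DecidableEquality ElementKind
k ≟ₖ k′ = map′ index-injective (cong kindIndex) (kindIndex k Fin.≟ kindIndex k′)
  where
  index-injective : kindIndex k ≡ kindIndex k′ → k ≡ k′
  index-injective eq = trans (sym (lookup-kindIndex k))
                             (trans (cong (lookup elementKinds) eq) (lookup-kindIndex k′))

all-kinds? : {A : ElementKind → Set} → (∀ k → Dec (A k)) → Dec (∀ k → A k)
all-kinds? {A} A? = map′ (λ h k → subst A (lookup-kindIndex k) (h (kindIndex k)))
                         (λ h c → h (lookup elementKinds c))
                         (all? (λ c → A? (lookup elementKinds c)))

δₑ : ElementKind → Arc → ℕ
δₑ (inj₁ κ) x = δ κ x
δₑ (inj₂ pq) x = δ P x ⊓ δ Q x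
δₑ (inj₂ pp) x = δ P x ⊓ δ P (forward x)
δₑ (inj₂ qq) x = δ Q x ⊓ δ Q (forward x)
δₑ (inj₂ rq) x = δ R x ⊓ δ Q x
δₑ (inj₂ rq') x = δ R x ⊓ δ Q (forward x)
δₑ (inj₂ rs) x = δ R x ⊓ δ S x

probeShift : Fin 4 → Arc → Arc
probeShift 0F x = x
probeShift 1F x = backward x
probeShift 2F x = forward x
probeShift 3F x = forward (forward x)

-- With i the index of the first element, σ selects the landmark s_i, s_{i+1}, s_{i-1} or s_{i-2}
-- (probeBase below); an element at arc x from i lies at arc probeShift σ x from it.
Separated : ℕ → ElementKind → ElementKind → Arc → Set
Separated n k₁ k₂ x = ∃[ σ ] (δₑ k₁ (probeShift σ (0 , n)) ≢ δₑ k₂ (probeShift σ x))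

-- The pairs of elements with a common index that no landmark separates.
Twins : ElementKind → ElementKind → Set
Twins k₁ k₂ = k₁ ≡ k₂ ⊎ (k₁ ≡ inj₁ Q × k₂ ≡ inj₂ pq) ⊎ (k₁ ≡ inj₂ pq × k₂ ≡ inj₁ Q)

Resolved : ℕ → Arc → Set
Resolved n x = ∀ k₁ k₂ → Separated n k₁ k₂ x ⊎ (proj₁ x ≡ 0 × Twins k₁ k₂)

resolved? : ∀ n x → Dec (Resolved n x)
resolved? n x = all-kinds? λ k₁ → all-kinds? λ k₂ →
  any? (λ σ → ¬? (δₑ k₁ (probeShift σ (0 , n)) ≟ δₑ k₂ (probeShift σ x)))
  ⊎-dec (proj₁ x ≟ 0 ×-dec (k₁ ≟ₖ k₂ ⊎-dec (k₁ ≟ₖ inj₁ Q ×-dec k₂ ≟ₖ inj₂ pq)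
                                       ⊎-dec (k₁ ≟ₖ inj₂ pq ×-dec k₂ ≟ₖ inj₁ Q)))

resolved-by-computation : ∀ n x → {True (resolved? n x)} → Resolved n x
resolved-by-computation n x {ok} = toWitness ok

-- The check also evaluates with n, t and w symbolic, provided the arcs it inspects carry enough
-- successors; n ≥ 7 suffices.
resolved-far : ∀ m t w → w + (3 + t) ≡ 7 + m → 1 ≤ w → Resolved (7 + m) (3 + t , w)
resolved-far m t 1 refl _ = resolved-by-computation (7 + m) (6 + m , 1)
resolved-far m t 2 refl _ = resolved-by-computation (7 + m) (5 + m , 2)
resolved-far m t (suc (suc (suc w))) _ _ = resolved-by-computation (7 + m) (3 + t , 3 + w)

resolved-large : ∀ m t w → t + w ≡ 7 + m → 1 ≤ w → Resolved (7 + m) (t , w)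
resolved-large m 0 _ refl _ = resolved-by-computation (7 + m) (0 , 7 + m)
resolved-large m 1 _ refl _ = resolved-by-computation (7 + m) (1 , 6 + m)
resolved-large m 2 _ refl _ = resolved-by-computation (7 + m) (2 , 5 + m)
resolved-large m (suc (suc (suc t))) w eq = resolved-far m t w (trans (+-comm w (3 + t)) eq)

resolved-by-enumeration : ∀ n → True (allUpTo? (λ t → resolved? n (t , n ∸ t)) n) →
                          ∀ {t} → t < n → Resolved n (t , n ∸ t)
resolved-by-enumeration n ok = toWitness ok

resolved : ∀ n → 4 ≤ n → ∀ {t} → t < n → Resolved n (t , n ∸ t)
resolved 1 (s≤s ())
resolved 2 (s≤s (s≤s ()))
resolved 3 (s≤s (s≤s (s≤s ())))
resolved 4 _ = resolved-by-enumeration 4 _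
resolved 5 _ = resolved-by-enumeration 5 _
resolved 6 _ = resolved-by-enumeration 6 _
resolved (suc (suc (suc (suc (suc (suc (suc m))))))) _ {t} t<n =
  resolved-large m t _ (m+[n∸m]≡n (<⇒≤ t<n)) (m<n⇒0<n∸m t<n)

module Prism (m : ℕ) where

  n : ℕ
  n = suc m

  toℕ-next : (i : Fin n) → toℕ (next i) ≡ suc (toℕ i) % n
  toℕ-next i = toℕ-fromℕ< _

  offset : Fin n → Fin n → ℕ
  offset j i = (toℕ i + (n ∸ toℕ j)) % n

  offset<n : ∀ j i → offset j i < n
  offset<n j i = m%n<n (toℕ i + (n ∸ toℕ j)) n

  offset-+-base : ∀ j i → (offset j i + toℕ j) % n ≡ toℕ i
  offset-+-base j i = begin
    ((a + (n ∸ b)) % n + b) % n ≡⟨ [m%n+o]%n≡[m+o]%n (a + (n ∸ b)) b n ⟩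
    (a + (n ∸ b) + b) % n       ≡⟨ cong (_% n) (+-assoc a (n ∸ b) b) ⟩
    (a + ((n ∸ b) + b)) % n     ≡⟨ cong (λ z → (a + z) % n) (m∸n+n≡m (<⇒≤ (toℕ<n j))) ⟩
    (a + n) % n                 ≡⟨ [m+n]%n≡m%n a n ⟩
    a % n                       ≡⟨ m<n⇒m%n≡m (toℕ<n i) ⟩
    a                           ∎
    where
    open ≡-Reasoning
    a = toℕ i
    b = toℕ j

  offset-unique : ∀ {t} j i → t < n → (t + toℕ j) % n ≡ toℕ i → offset j i ≡ t
  offset-unique {t} j i t<n t+b≡a = begin
    (toℕ i + (n ∸ b)) % n       ≡⟨ cong (λ a → (a + (n ∸ b)) % n) t+b≡a ⟨
    ((t + b) % n + (n ∸ b)) % n ≡⟨ [m%n+o]%n≡[m+o]%n (t + b) (n ∸ b) n ⟩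
    (t + b + (n ∸ b)) % n       ≡⟨ cong (_% n) (+-assoc t b (n ∸ b)) ⟩
    (t + (b + (n ∸ b))) % n     ≡⟨ cong (λ z → (t + z) % n) (m+[n∸m]≡n (<⇒≤ (toℕ<n j))) ⟩
    (t + n) % n                 ≡⟨ [m+n]%n≡m%n t n ⟩
    t % n                       ≡⟨ m<n⇒m%n≡m t<n ⟩
    t                           ∎
    where
    open ≡-Reasoning
    b = toℕ j

  offset-self : ∀ j → offset j j ≡ 0
  offset-self j = offset-unique j j (s≤s z≤n) (m<n⇒m%n≡m (toℕ<n j))

  offset≡0⇒≡ : ∀ {j i} → offset j i ≡ 0 → i ≡ j
  offset≡0⇒≡ {j} {i} o≡0 = toℕ-injective (begin
    toℕ i                    ≡⟨ offset-+-base j i ⟨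
    (offset j i + toℕ j) % n ≡⟨ cong (λ o → (o + toℕ j) % n) o≡0 ⟩
    toℕ j % n                ≡⟨ m<n⇒m%n≡m (toℕ<n j) ⟩
    toℕ j                    ∎)
    where open ≡-Reasoning

  offset-next : ∀ j i → offset j (next i) ≡ suc (offset j i) % n
  offset-next j i = offset-unique j (next i) (m%n<n (suc (offset j i)) n) (begin
    (suc o % n + toℕ j) % n   ≡⟨ [m%n+o]%n≡[m+o]%n (suc o) (toℕ j) n ⟩
    suc (o + toℕ j) % n       ≡⟨ [m+o%n]%n≡[m+o]%n 1 (o + toℕ j) n ⟨
    suc ((o + toℕ j) % n) % n ≡⟨ cong (λ a → suc a % n) (offset-+-base j i) ⟩
    suc (toℕ i) % n           ≡⟨ toℕ-next i ⟨
    toℕ (next i)              ∎)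
    where
    open ≡-Reasoning
    o = offset j i

  offset-next-base : ∀ j i → offset j i ≡ suc (offset (next j) i) % n
  offset-next-base j i = offset-unique j i (m%n<n (suc o) n) (begin
    (suc o % n + toℕ j) % n       ≡⟨ [m%n+o]%n≡[m+o]%n (suc o) (toℕ j) n ⟩
    (suc o + toℕ j) % n           ≡⟨ cong (_% n) (+-suc o (toℕ j)) ⟨
    (o + suc (toℕ j)) % n         ≡⟨ [m+o%n]%n≡[m+o]%n o (suc (toℕ j)) n ⟨
    (o + suc (toℕ j) % n) % n     ≡⟨ cong (λ b → (o + b) % n) (toℕ-next j) ⟨
    (o + toℕ (next j)) % n        ≡⟨ offset-+-base (next j) i ⟩
    toℕ i                         ∎)
    where
    open ≡-Reasoning
    o = offset (next j) i

  position : Fin n → Fin n → Arc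
  position j i = offset j i , n ∸ offset j i

  suc-∸ : ∀ {t} → t ≤ m → n ∸ t ≡ suc (m ∸ t)
  suc-∸ = +-∸-assoc 1

  position-shape : ∀ j i → position j i ≡ (offset j i , suc (m ∸ offset j i))
  position-shape j i = cong (offset j i ,_) (suc-∸ (≤-pred (offset<n j i)))

  forward-arc : ∀ {t} → t < n → forward (t , n ∸ t) ≡ (suc t % n , n ∸ (suc t % n))
  forward-arc {t} (s≤s t≤m) with m≤n⇒m<n∨m≡n t≤m
  ... | inj₁ t<m rewrite m<n⇒m%n≡m (s≤s t<m) | suc-∸ t≤m | suc-∸ t<m = refl
  ... | inj₂ refl rewrite n%n≡0 n {{_}} | suc-∸ t≤m | n∸n≡0 m = refl

  position-next : ∀ j i → position j (next i) ≡ forward (position j i)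
  position-next j i rewrite offset-next j i = sym (forward-arc (offset<n j i))

  position-next-base : ∀ j i → position j i ≡ forward (position (next j) i)
  position-next-base j i rewrite offset-next-base j i = sym (forward-arc (offset<n (next j) i))

  position-self : ∀ j → position j j ≡ (0 , n)
  position-self j = cong (λ o → o , n ∸ o) (offset-self j)

  backward-forward-position : ∀ j i → backward (forward (position j i)) ≡ position j i
  backward-forward-position j i rewrite position-shape j i = backward-forward _ _

  position-next-base′ : ∀ j i → position (next j) i ≡ backward (position j i)
  position-next-base′ j i = begin
    position (next j) i                     ≡⟨ backward-forward-position (next j) i ⟨
    backward (forward (position (next j) i)) ≡⟨ cong backward (position-next-base j i) ⟨
    backward (position j i)                 ∎
    where open ≡-Reasoning

  prev : Fin n → Fin n
  prev Fin.zero = Fin.fromℕ m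
  prev (Fin.suc i) = Fin.inject₁ i

  next-prev : ∀ i → next (prev i) ≡ i
  next-prev Fin.zero = toℕ-injective (begin
    toℕ (next (Fin.fromℕ m)) ≡⟨ toℕ-next (Fin.fromℕ m) ⟩
    suc (toℕ (Fin.fromℕ m)) % n ≡⟨ cong (λ a → suc a % n) (toℕ-fromℕ m) ⟩
    n % n                    ≡⟨ n%n≡0 n ⟩
    0                        ∎)
    where open ≡-Reasoning
  next-prev (Fin.suc i) = toℕ-injective (begin
    toℕ (next (Fin.inject₁ i))    ≡⟨ toℕ-next (Fin.inject₁ i) ⟩
    suc (toℕ (Fin.inject₁ i)) % n ≡⟨ cong (λ a → suc a % n) (toℕ-inject₁ i) ⟩
    suc (toℕ i) % n               ≡⟨ m<n⇒m%n≡m (s≤s (toℕ<n i)) ⟩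
    suc (toℕ i)                   ∎)
    where open ≡-Reasoning

  position-prev : ∀ j i → position j (prev i) ≡ backward (position j i)
  position-prev j i = begin
    position j (prev i)                     ≡⟨ backward-forward-position j (prev i) ⟨
    backward (forward (position j (prev i))) ≡⟨ cong backward (position-next j (prev i)) ⟨
    backward (position j (next (prev i)))   ≡⟨ cong (λ k → backward (position j k)) (next-prev i) ⟩
    backward (position j i)                 ∎
    where open ≡-Reasoning

  position-prev-base : ∀ j i → position (prev j) i ≡ forward (position j i)
  position-prev-base j i = begin
    position (prev j) i                    ≡⟨ position-next-base (prev j) i ⟩
    forward (position (next (prev j)) i)   ≡⟨ cong (λ k → forward (position k i)) (next-prev j) ⟩
    forward (position j i)                 ∎
    where open ≡-Reasoning

  probeBase : Fin 4 → Fin n → Fin n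
  probeBase 0F j = j
  probeBase 1F j = next j
  probeBase 2F j = prev j
  probeBase 3F j = prev (prev j)

  position-probeBase : ∀ σ j i → position (probeBase σ j) i ≡ probeShift σ (position j i)
  position-probeBase 0F j i = refl
  position-probeBase 1F j i = position-next-base′ j i
  position-probeBase 2F j i = position-prev-base j i
  position-probeBase 3F j i = trans (position-prev-base (prev j) i) (cong forward (position-prev-base j i))

  sDist : Fin n → Vertex n → ℕ
  sDist j (κ , i) = δ κ (position j i)

  on-arc : ∀ j i (C : Arc → Set) → (∀ t w → C (t , suc w)) → C (position j i)
  on-arc j i C h rewrite position-shape j i = h _ _

  on-arc-next : ∀ j i (C : Arc → Arc → Set) → (∀ t w → C (t , suc w) (forward (t , suc w))) →
                C (position j i) (position j (next i))
  on-arc-next j i C h =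
    subst (C (position j i)) (sym (position-next j i)) (on-arc j i (λ x → C x (forward x)) h)

  sDist-edge : ∀ j (e : Edge n) → Close (sDist j (proj₁ (ends e))) (sDist j (proj₂ (ends e)))
  sDist-edge j (pq , i) = δ-PQ (position j i)
  sDist-edge j (pp , i) = on-arc-next j i (λ x y → Close (δ P x) (δ P y)) δ-PP-forward
  sDist-edge j (qq , i) = on-arc-next j i (λ x y → Close (δ Q x) (δ Q y)) δ-QQ-forward
  sDist-edge j (rq , i) = on-arc j i (λ x → Close (δ R x) (δ Q x)) δ-RQ
  sDist-edge j (rq' , i) = on-arc-next j i (λ x y → Close (δ R x) (δ Q y)) δ-RQ-forward
  sDist-edge j (rs , i) = on-arc j i (λ x → Close (δ R x) (δ S x)) δ-RS

  sDist-lipschitz : ∀ j {u v} → Adj u v → sDist j v ≤ suc (sDist j u)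
  sDist-lipschitz j (e , inj₁ refl) = proj₂ (sDist-edge j e)
  sDist-lipschitz j (e , inj₂ refl) = proj₁ (sDist-edge j e)

  adj-to-next : ∀ {κ κ′} (l : ELabel) i → ends (l , prev i) ≡ ((κ , prev i) , (κ′ , next (prev i))) →
                Adj {n} (κ , prev i) (κ′ , i)
  adj-to-next l i e = subst (λ k → Adj (_ , prev i) (_ , k)) (next-prev i) ((l , prev i) , inj₁ e)

  sDist-descent : ∀ j v k → sDist j v ≡ suc k → ∃[ w ] (Adj w v × sDist j w ≡ k)
  sDist-descent j (S , i) k eq
    with on-arc j i (Descends S) (δ-descends S)
  ... | inj₁ z = contradiction (trans (sym z) eq) 0≢1+n
  ... | inj₂ c = (R , i) , ends-adjacent (rs , i) , one-less c eq
  sDist-descent j (R , i) k eq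
    with on-arc j i (Descends R) (δ-descends R)
  ... | inj₁ c = (S , i) , ends-adjacent′ (rs , i) , one-less c eq
  ... | inj₂ (inj₁ c) = (Q , i) , ends-adjacent′ (rq , i) , one-less c eq
  ... | inj₂ (inj₂ c) = (Q , next i) , ends-adjacent′ (rq' , i) ,
                        trans (cong (δ Q) (position-next j i)) (one-less c eq)
  sDist-descent j (Q , i) k eq
    with on-arc j i (Descends Q) (δ-descends Q)
  ... | inj₁ c = (R , i) , ends-adjacent (rq , i) , one-less c eq
  ... | inj₂ (inj₁ c) = (R , prev i) , adj-to-next rq' i refl ,
                        trans (cong (δ R) (position-prev j i)) (one-less c eq)
  ... | inj₂ (inj₂ (inj₁ c)) = (Q , prev i) , adj-to-next qq i refl ,
                               trans (cong (δ Q) (position-prev j i)) (one-less c eq)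
  ... | inj₂ (inj₂ (inj₂ c)) = (Q , next i) , ends-adjacent′ (qq , i) ,
                               trans (cong (δ Q) (position-next j i)) (one-less c eq)
  sDist-descent j (P , i) k eq =
    (Q , i) , ends-adjacent′ (pq , i) , one-less (on-arc j i (Descends P) (δ-descends P)) eq

  sDist-source : ∀ j → sDist j (S , j) ≡ 0
  sDist-source j = cong (δ S) (position-self j)

  sDist≡0 : ∀ j v → sDist j v ≡ 0 → v ≡ (S , j)
  sDist≡0 j (κ , i) e with δ≡0 κ (position j i) e
  ... | refl , o≡0 = cong (S ,_) (offset≡0⇒≡ o≡0)

  dist-from-S : ∀ j v → Dist (S , j) v (sDist j v)
  dist-from-S j = dist-from-potential (S , j) (sDist j) (sDist-lipschitz j) (sDist-descent j)
                                      (sDist-source j) (sDist≡0 j)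

  element : ElementKind → Fin n → Element n
  element (inj₁ κ) i = inj₁ (κ , i)
  element (inj₂ l) i = inj₂ (l , i)

  element-surjective : (y : Element n) → ∃[ k ] ∃[ i ] element k i ≡ y
  element-surjective (inj₁ (κ , i)) = inj₁ κ , i , refl
  element-surjective (inj₂ (l , i)) = inj₂ l , i , refl

  dist-from-S-next : ∀ j κ i → Dist (S , j) (κ , next i) (δ κ (forward (position j i)))
  dist-from-S-next j κ i =
    subst (Dist (S , j) (κ , next i)) (cong (δ κ) (position-next j i)) (dist-from-S j (κ , next i))

  distEl-from-S : ∀ j k i → DistEl (S , j) (element k i) (δₑ k (position j i))
  distEl-from-S j (inj₁ κ) i = dist-from-S j (κ , i)
  distEl-from-S j (inj₂ pq) i = DistEl-edge {e = pq , i} (dist-from-S j (P , i)) (dist-from-S j (Q , i))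
  distEl-from-S j (inj₂ pp) i = DistEl-edge {e = pp , i} (dist-from-S j (P , i)) (dist-from-S-next j P i)
  distEl-from-S j (inj₂ qq) i = DistEl-edge {e = qq , i} (dist-from-S j (Q , i)) (dist-from-S-next j Q i)
  distEl-from-S j (inj₂ rq) i = DistEl-edge {e = rq , i} (dist-from-S j (R , i)) (dist-from-S j (Q , i))
  distEl-from-S j (inj₂ rq') i = DistEl-edge {e = rq' , i} (dist-from-S j (R , i)) (dist-from-S-next j Q i)
  distEl-from-S j (inj₂ rs) i = DistEl-edge {e = rs , i} (dist-from-S j (R , i)) (dist-from-S j (S , i))

  probe-distinguishes : ∀ σ k₁ i₁ k₂ i₂ →
                        δₑ k₁ (probeShift σ (0 , n)) ≢ δₑ k₂ (probeShift σ (position i₁ i₂)) →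
                        Distinguishes (S , probeBase σ i₁) (element k₁ i₁) (element k₂ i₂)
  probe-distinguishes σ k₁ i₁ k₂ i₂ d =
    distinguishes (distEl-from-S _ k₁ i₁) (distEl-from-S _ k₂ i₂)
                  (subst₂ (λ a b → δₑ k₁ a ≢ δₑ k₂ b) (sym at-i₁) (sym (position-probeBase σ i₁ i₂)) d)
    where
    at-i₁ : position (probeBase σ i₁) i₁ ≡ probeShift σ (0 , n)
    at-i₁ = trans (position-probeBase σ i₁ i₁) (cong (probeShift σ) (position-self i₁))

  S-row : List (Vertex n)
  S-row = map (S ,_) (allFin n)

  basis : List (Vertex n)
  basis = (P , Fin.zero) ∷ S-row

  S∈S-row : ∀ j → (S , j) ∈ S-row
  S∈S-row j = ∈-map⁺ (S ,_) (∈-allFin j)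

  separate : 4 ≤ n → ∀ k₁ i₁ k₂ i₂ → element k₁ i₁ ≢ element k₂ i₂ →
             ∃[ z ] (z ∈ basis × Distinguishes z (element k₁ i₁) (element k₂ i₂))
  separate 4≤n k₁ i₁ k₂ i₂ y₁≢y₂ with resolved n 4≤n (offset<n i₁ i₂) k₁ k₂
  ... | inj₁ (σ , d) = (S , probeBase σ i₁) , there (S∈S-row _) , probe-distinguishes σ k₁ i₁ k₂ i₂ d
  ... | inj₂ (o≡0 , twins) with offset≡0⇒≡ {i₁} {i₂} o≡0
  ... | refl with twins
  ... | inj₁ refl = contradiction refl y₁≢y₂
  ... | inj₂ (inj₁ (refl , refl)) = (P , Fin.zero) , here refl , rung-separated
  ... | inj₂ (inj₂ (refl , refl)) = (P , Fin.zero) , here refl , rung-separated′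

  basis-generates : 4 ≤ n → MixedMetricGenerator n basis
  basis-generates 4≤n y₁ y₂ y₁≢y₂ with element-surjective y₁ | element-surjective y₂
  ... | k₁ , i₁ , refl | k₂ , i₂ , refl = separate 4≤n k₁ i₁ k₂ i₂ y₁≢y₂

  next-zero≢zero : 1 ≤ m → next {n} Fin.zero ≢ Fin.zero
  next-zero≢zero 1≤m eq = 1+n≢0 (begin
    1                      ≡⟨ m<n⇒m%n≡m (s≤s 1≤m) ⟨
    1 % n                  ≡⟨ toℕ-next Fin.zero ⟨
    toℕ (next {n} Fin.zero) ≡⟨ cong toℕ eq ⟩
    0                      ∎)
    where open ≡-Reasoning

  basis-members : ∀ {u} → u ∈ basis → u ≡ (P , Fin.zero) ⊎ ∃[ j ] u ≡ (S , j)
  basis-members (here u≡p₀) = inj₁ u≡p₀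
  basis-members (there u∈) with ∈-map⁻ (S ,_) u∈
  ... | j , _ , u≡sⱼ = inj₂ (j , u≡sⱼ)

  R∉basis : ∀ {j} → (R , j) ∉ basis
  R∉basis r∈ with basis-members r∈
  ... | inj₁ ()
  ... | inj₂ (_ , ())

  basis-independent : 1 ≤ m → Independent n basis
  basis-independent 1≤m u∈ v∈ u~v with basis-members u∈ | basis-members v∈
  ... | _ | inj₂ (j , refl) = R∉basis (subst (_∈ basis) (S-neighbour u~v) u∈)
  ... | inj₂ (j , refl) | _ = R∉basis (subst (_∈ basis) (S-neighbour (Adj-sym u~v)) v∈)
  ... | inj₁ refl | inj₁ refl with adj-on-rim u~v
  ... | inj₁ 0≡next0 = next-zero≢zero 1≤m (sym 0≡next0)
  ... | inj₂ 0≡next0 = next-zero≢zero 1≤m (sym 0≡next0)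

  S-row-unique : ∀ {z} → proj₁ z ≢ S → Unique (z ∷ S-row)
  S-row-unique {z} z≢S = All.tabulate z∉S-row ∷ Unique.map⁺ (cong proj₂) (Unique.allFin⁺ n)
    where
    z∉S-row : ∀ {x} → x ∈ S-row → z ≢ x
    z∉S-row x∈ with ∈-map⁻ (S ,_) x∈
    ... | _ , _ , refl = λ z≡x → z≢S (cong proj₁ z≡x)

  length-S-row : ∀ z → length (z ∷ S-row) ≡ n + 1
  length-S-row z = begin
    suc (length S-row)      ≡⟨ cong suc (length-map {B = Vertex n} (S ,_) (allFin n)) ⟩
    suc (length (allFin n)) ≡⟨ cong suc (length-tabulate {n = n} id) ⟩
    suc n                   ≡⟨ +-comm 1 n ⟩
    n + 1                   ∎
    where open ≡-Reasoning

  S-blind-to-rung : ∀ j i → ¬ Distinguishes (S , j) (inj₁ (Q , i)) (inj₂ (pq , i))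
  S-blind-to-rung j i separates = separates _ _ (distEl-from-S j (inj₁ Q) i) (distEl-from-S j (inj₂ pq) i)
                                            (sym (m≥n⇒m⊓n≡n (n≤1+n _)))

  rung-separator-not-S : ∀ {z} i → Distinguishes z (inj₁ (Q , i)) (inj₂ (pq , i)) → proj₁ z ≢ S
  rung-separator-not-S {S , j} i separates refl = S-blind-to-rung j i separates

  lower-bound : ∀ M → MixedMetricGenerator n M → n + 1 ≤ length M
  lower-bound M generates with generates (inj₁ (Q , Fin.zero)) (inj₂ (pq , Fin.zero)) (λ ())
  ... | z , z∈M , separates = begin
    n + 1              ≡⟨ length-S-row z ⟨
    length (z ∷ S-row) ≤⟨ ⊆⇒length≤ (S-row-unique (rung-separator-not-S Fin.zero separates)) ⊆M ⟩
    length M           ∎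
    where
    open ≤-Reasoning
    S∈M : ∀ i → (S , i) ∈ M
    S∈M i with generates (inj₁ (R , i)) (inj₂ (rs , i)) (λ ())
    ... | z′ , z′∈M , separates′ =
      subst (_∈ M) (rs-separated-only-by-S (Dist-sym (dist-from-S i z′)) separates′) z′∈M
    ⊆M : (z ∷ S-row) ⊆ M
    ⊆M (here refl) = z∈M
    ⊆M (there x∈) with ∈-map⁻ (S ,_) x∈
    ... | i , _ , refl = S∈M i

theorem6 : ∀ (n : ℕ) → 4 ≤ n → IsIndependentMixedMetricNumber n (n + 1)
theorem6 (suc m) 4≤n =
  ( basis , S-row-unique (λ ())
  , (basis-independent 1≤m , basis-generates 4≤n)
  , length-S-row (P , Fin.zero))
  , λ M _ (_ , generates) → lower-bound M generates
  where
  open Prism m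
  1≤m : 1 ≤ m
  1≤m = ≤-trans (s≤s z≤n) (≤-pred 4≤n)
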